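{- For every bipartite graph $G$, $2\nu_{ss}(G)\le\gamma_{\rm gr}^t(G)\le 2\nu(G)$.
   Context: All graphs are finite and simple. For a vertex $v$, $N(v)$ is its open neighborhood. A sequence $(v_1,\ldots,v_k)$ of distinct vertices is legal if for every $i\in\{1,\ldots,k\}$, $N(v_i)\setminus\bigcup_{j=1}^{i-1}N(v_j)\neq\emptyset$. $\gamma_{\rm gr}^t(G)$ is the maximum length of a legal sequence. $\nu(G)$ is the matching number (maximum number of edges in a matching). For a matching $M$, a vertex incident to an edge of $M$ is strong if it has degree $1$ in the subgraph $G[V(M)]$ induced by the vertices covered by $M$; $M$ is semistrong if every edge of $M$ has at least one strong endpoint; $\nu_{ss}(G)$ is the maximum number of edges in a semistrong matching of $G$. -}

module Defs where

open import Data.Nat using (ℕ; _≤_)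
open import Data.Fin using (Fin)
open import Data.Bool using (Bool; true; false; _≟_)
open import Data.List using (List; []; _∷_; length; filter; concatMap)
open import Data.List.Relation.Unary.All using (All)
open import Data.List.Relation.Unary.Unique.Propositional using (Unique)
open import Data.Product using (_×_; _,_; ∃; Σ)
open import Data.Sum using (_⊎_)
open import Relation.Binary.PropositionalEquality using (_≡_)
open import Relation.Nullary using (¬_)

record Graph (n : ℕ) : Set where
  field
    adj   : Fin n → Fin n → Bool
    sym   : ∀ u v → adj u v ≡ adj v u
    irrefl : ∀ v → adj v v ≡ false
open Graph public

module _ {n : ℕ} (G : Graph n) where

  Adj : Fin n → Fin n → Set
  Adj v u = adj G v u ≡ true

  Bipartite : Set
  Bipartite = Σ (Fin n → Bool) λ c → ∀ u v → Adj u v → ¬ (c u ≡ c v)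

  Legal' : List (Fin n) → List (Fin n) → Set
  Legal' prev [] = Data.Unit.⊤ where import Data.Unit
  Legal' prev (v ∷ vs) =
    (∃ λ u → Adj v u × All (λ w → ¬ Adj w u) prev) × Legal' (v ∷ prev) vs

  -- A legal sequence (v₁,…,vₖ) of distinct vertices:
  -- N(vᵢ) ∖ ⋃_{j<i} N(vⱼ) ≠ ∅ for all i.
  Legal : List (Fin n) → Set
  Legal vs = Unique vs × Legal' [] vs

  IsGrundyTotalDomNumber : ℕ → Set
  IsGrundyTotalDomNumber k =
    (∃ λ vs → Legal vs × length vs ≡ k) × (∀ vs → Legal vs → length vs ≤ k)

  covered : List (Fin n × Fin n) → List (Fin n)
  covered = concatMap (λ { (u , v) → u ∷ v ∷ [] })

  -- M is a matching: every pair is an edge, and the covered vertices are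
  -- pairwise distinct (so edges are disjoint and listed once).
  Matching : List (Fin n × Fin n) → Set
  Matching M = All (λ { (u , v) → Adj u v }) M × Unique (covered M)

  IsMatchingNumber : ℕ → Set
  IsMatchingNumber m =
    (∃ λ M → Matching M × length M ≡ m) × (∀ M → Matching M → length M ≤ m)

  Strong : List (Fin n × Fin n) → Fin n → Set
  Strong M x = length (filter (λ y → adj G x y ≟ true) (covered M)) ≡ 1

  Semistrong : List (Fin n × Fin n) → Set
  Semistrong M = Matching M × All (λ { (u , v) → Strong M u ⊎ Strong M v }) M

  IsSemistrongMatchingNumber : ℕ → Set
  IsSemistrongMatchingNumber s =
    (∃ λ M → Semistrong M × length M ≡ s) × (∀ M → Semistrong M → length M ≤ s)

-- Upper bound: a legal sequence v₁ … v_k comes with footprints uᵢ ∈ N(vᵢ) that are not adjacent to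
-- any earlier vⱼ, so the uᵢ are distinct. In a bipartite graph the vᵢ of one colour class lie in an
-- independent set, hence their edges vᵢuᵢ form a matching; the two colour classes give k ≤ 2ν.
-- Lower bound (valid in every graph): orient a semistrong matching as edges xᵢyᵢ with xᵢ strong.
-- Then x₁ … x_s y₁ … y_s is legal with footprints y₁ … y_s x₁ … x_s, because the only neighbour of
-- xᵢ among the matched vertices is yᵢ.
module Submission where

open import Defs hiding (sym)
open import Data.Bool using (Bool; true; false; _≟_)
open import Data.Fin using (Fin)
open import Data.List using (List; []; _∷_; _++_; map; filter; length)
open import Data.List.Properties using (map-++; map-∘; length-map; length-++)
open import Data.List.Membership.Propositional using (_∈_)
open import Data.List.Membership.Propositional.Properties
  using (∈-filter⁺; ∈-map⁺; ∈-map⁻; ∈-++⁺ˡ; ∈-++⁺ʳ)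
open import Data.List.Relation.Binary.Disjoint.Propositional using (Disjoint)
open import Data.List.Relation.Binary.Permutation.Propositional
  using (_↭_; ↭-refl; ↭-prep; ↭-swap; ↭-trans; ↭-sym; ↭⇒↭ₛ)
open import Data.List.Relation.Binary.Permutation.Propositional.Properties using (shift; ∈-resp-↭)
import Data.List.Relation.Binary.Permutation.Setoid.Properties as ↭ₛ
open import Data.List.Relation.Unary.All as All using (All; []; _∷_)
import Data.List.Relation.Unary.All.Properties as Allₚ
open import Data.List.Relation.Unary.AllPairs using (AllPairs; []; _∷_)
import Data.List.Relation.Unary.AllPairs.Properties as AllPairsₚ
open import Data.List.Relation.Unary.Any using (here; there)
open import Data.List.Relation.Unary.Unique.Propositional using (Unique)
import Data.List.Relation.Unary.Unique.Propositional.Properties as Uniqueₚ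
open import Data.Nat using (ℕ; suc; _+_; _*_; _≤_)
open import Data.Nat.Properties using (+-suc; +-identityʳ; +-mono-≤; module ≤-Reasoning)
open import Data.Product using (_×_; _,_; proj₁; proj₂; ∃-syntax; swap)
open import Data.Sum using (_⊎_; inj₁; inj₂)
open import Data.Unit using (tt)
open import Function using (_∘_)
open import Relation.Binary.PropositionalEquality
  using (_≡_; refl; sym; trans; cong; cong₂; subst; setoid)
open import Relation.Nullary using (¬_)
open import Relation.Unary using (Decidable)

module _ {a} {A : Set a} where

  ∈-length≡1 : ∀ {ws : List A} {y z} → length ws ≡ 1 → y ∈ ws → z ∈ ws → z ≡ y
  ∈-length≡1 {_ ∷ []} _ (here refl) (here refl) = refl

  length-filter-true+false : (f : A → Bool) (xs : List A) →
    length (filter (λ x → f x ≟ true) xs) + length (filter (λ x → f x ≟ false) xs) ≡ length xs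
  length-filter-true+false f [] = refl
  length-filter-true+false f (x ∷ xs) with f x
  ... | true  = cong suc (length-filter-true+false f xs)
  ... | false = trans (+-suc _ _) (cong suc (length-filter-true+false f xs))

  unique-resp-↭ : ∀ {xs ys : List A} → xs ↭ ys → Unique xs → Unique ys
  unique-resp-↭ p = ↭ₛ.Unique-resp-↭ (setoid A) (↭⇒↭ₛ p)

  unique-++⁻ : ∀ xs {ys : List A} → Unique (xs ++ ys) → Unique xs × Unique ys × Disjoint xs ys
  unique-++⁻ [] u = [] , u , λ { (() , _) }
  unique-++⁻ (x ∷ xs) (x∉ ∷ u) with uxs , uys , disj ← unique-++⁻ xs u =
    Allₚ.++⁻ˡ xs x∉ ∷ uxs , uys , λ where
      (here refl , x∈ys)  → All.lookup (Allₚ.++⁻ʳ xs x∉) x∈ys refl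
      (there v∈xs , v∈ys) → disj (v∈xs , v∈ys)

  allPairs-mapWith∈ : ∀ {r s} {R : A → A → Set r} {S : A → A → Set s} {xs} →
    (∀ {x y} → x ∈ xs → y ∈ xs → R x y → S x y) → AllPairs R xs → AllPairs S xs
  allPairs-mapWith∈ f [] = []
  allPairs-mapWith∈ f (r ∷ rs) =
    All.tabulate (λ y∈ → f (here refl) (there y∈) (All.lookup r y∈))
    ∷ allPairs-mapWith∈ (λ x∈ y∈ → f (there x∈) (there y∈)) rs

  module _ {p} {P : A → Set p} where

    orient : (M : List (A × A)) → All (λ (u , v) → P u ⊎ P v) M → List (A × A)
    orient [] [] = []
    orient (e ∷ M) (inj₁ _ ∷ ps) = e ∷ orient M ps
    orient (e ∷ M) (inj₂ _ ∷ ps) = swap e ∷ orient M ps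

    orient-length : ∀ M ps → length (orient M ps) ≡ length M
    orient-length [] [] = refl
    orient-length (e ∷ M) (inj₁ _ ∷ ps) = cong suc (orient-length M ps)
    orient-length (e ∷ M) (inj₂ _ ∷ ps) = cong suc (orient-length M ps)

    orient-first : ∀ M ps → All (P ∘ proj₁) (orient M ps)
    orient-first [] [] = []
    orient-first (e ∷ M) (inj₁ pu ∷ ps) = pu ∷ orient-first M ps
    orient-first (e ∷ M) (inj₂ pv ∷ ps) = pv ∷ orient-first M ps

    orient⁺ : ∀ {q} {Q : A × A → Set q} → (∀ {e} → Q e → Q (swap e)) →
              ∀ M ps → All Q M → All Q (orient M ps)
    orient⁺ Q-swap [] [] [] = []
    orient⁺ Q-swap (e ∷ M) (inj₁ _ ∷ ps) (q ∷ qs) = q ∷ orient⁺ Q-swap M ps qs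
    orient⁺ Q-swap (e ∷ M) (inj₂ _ ∷ ps) (q ∷ qs) = Q-swap q ∷ orient⁺ Q-swap M ps qs

module _ {n : ℕ} (G : Graph n) where

  adj-sym : ∀ {u v} → Adj G u v → Adj G v u
  adj-sym {u} {v} = trans (Graph.sym G v u)

  IsEdge : Fin n × Fin n → Set
  IsEdge (v , u) = Adj G v u

  Independent : (Fin n → Set) → Set
  Independent Q = ∀ {x y} → Q x → Q y → ¬ Adj G x y

  endpoints : List (Fin n × Fin n) → List (Fin n)
  endpoints L = map proj₁ L ++ map proj₂ L

  length-endpoints : ∀ L → length (endpoints L) ≡ 2 * length L
  length-endpoints L = trans (length-++ (map proj₁ L))
    (cong₂ _+_ (length-map proj₁ L) (trans (length-map proj₂ L) (sym (+-identityʳ _))))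

  covered↭endpoints : ∀ L → covered G L ↭ endpoints L
  covered↭endpoints [] = ↭-refl
  covered↭endpoints ((x , y) ∷ L) = ↭-prep x (↭-trans (↭-prep y (covered↭endpoints L))
    (↭-sym (shift y (map proj₁ L) (map proj₂ L))))

  orient-covered : ∀ {p} {P : Fin n → Set p} M ps → covered G (orient {P = P} M ps) ↭ covered G M
  orient-covered [] [] = ↭-refl
  orient-covered ((u , v) ∷ M) (inj₁ _ ∷ ps) = ↭-prep u (↭-prep v (orient-covered M ps))
  orient-covered ((u , v) ∷ M) (inj₂ _ ∷ ps) = ↭-swap v u (orient-covered M ps)

  Footprints : List (Fin n) → List (Fin n × Fin n) → Set
  Footprints prev L =
    All (λ (v , u) → Adj G v u × All (λ w → ¬ Adj G w u) prev) L
    × AllPairs (λ (v , _) (_ , u) → ¬ Adj G v u) L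

  legal'⇒footprints : ∀ {prev} vs → Legal' G prev vs → ∃[ L ] map proj₁ L ≡ vs × Footprints prev L
  legal'⇒footprints [] _ = [] , refl , [] , []
  legal'⇒footprints (v ∷ vs) ((u , v∼u , u-new) , legal)
    with L , refl , later , pairs ← legal'⇒footprints vs legal =
    (v , u) ∷ L , refl ,
    (v∼u , u-new) ∷ All.map (λ (a , new) → a , All.tail new) later ,
    All.map (All.head ∘ proj₂) later ∷ pairs

  footprints⇒legal' : ∀ {prev} L → Footprints prev L → Legal' G prev (map proj₁ L)
  footprints⇒legal' [] _ = tt
  footprints⇒legal' ((v , u) ∷ L) ((v∼u , u-new) ∷ later , v≁later ∷ pairs) =
    (u , v∼u , u-new) ,
    footprints⇒legal' L (All.zipWith (λ ((a , new) , v≁) → a , v≁ ∷ new) (later , v≁later) , pairs)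

  footprints-filter⁺ : ∀ {p} {P : Fin n × Fin n → Set p} (P? : Decidable P) {prev L} →
                       Footprints prev L → Footprints prev (filter P? L)
  footprints-filter⁺ P? (new , pairs) = Allₚ.filter⁺ P? new , AllPairsₚ.filter⁺ P? pairs

  footprints⇒matching : ∀ {Q L} → Independent Q → All (Q ∘ proj₁) L → Unique (map proj₁ L) →
                        Footprints [] L → Matching G L
  footprints⇒matching {L = L} independent inQ unique-vs (new , pairs) =
    edges , unique-resp-↭ (↭-sym (covered↭endpoints L)) (Uniqueₚ.++⁺ unique-vs unique-us disjoint)
    where
    edges : All IsEdge L
    edges = All.map proj₁ new

    unique-us : Unique (map proj₂ L)
    unique-us = AllPairsₚ.map⁺ (allPairs-mapWith∈
      (λ e∈ _ v≁u′ u≡u′ → v≁u′ (subst (Adj G _) u≡u′ (All.lookup edges e∈))) pairs)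

    disjoint : Disjoint (map proj₁ L) (map proj₂ L)
    disjoint (v∈vs , v∈us)
      with e , e∈ , refl ← ∈-map⁻ proj₁ v∈vs | e′ , e′∈ , v≡u′ ← ∈-map⁻ proj₂ v∈us =
      independent (All.lookup inQ e′∈) (All.lookup inQ e∈)
        (subst (Adj G _) (sym v≡u′) (All.lookup edges e′∈))

  legal-length≤2*matching : Bipartite G → ∀ {m} → (∀ M → Matching G M → length M ≤ m) →
                            ∀ {vs} → Legal G vs → length vs ≤ 2 * m
  legal-length≤2*matching (c , proper) {m} ν-max (unique-vs , legal)
    with L , refl , footprints ← legal'⇒footprints _ legal = begin
      length (map proj₁ L)                        ≡⟨ length-map proj₁ L ⟩
      length L                                    ≡⟨ sym (length-filter-true+false (c ∘ proj₁) L) ⟩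
      length (class true) + length (class false)  ≤⟨ +-mono-≤ (ν-max _ (class-matching true))
                                                               (ν-max _ (class-matching false)) ⟩
      m + m                                       ≡⟨ cong (m +_) (sym (+-identityʳ m)) ⟩
      2 * m                                       ∎
    where
    open ≤-Reasoning

    class : Bool → List (Fin n × Fin n)
    class b = filter (λ e → c (proj₁ e) ≟ b) L

    class-matching : ∀ b → Matching G (class b)
    class-matching b = footprints⇒matching
      (λ cx≡b cy≡b x∼y → proper _ _ x∼y (trans cx≡b (sym cy≡b)))
      (Allₚ.all-filter _ L)
      (AllPairsₚ.map⁺ (AllPairsₚ.filter⁺ _ (AllPairsₚ.map⁻ unique-vs)))
      (footprints-filter⁺ _ footprints)

  UniqueNeighbourIn : List (Fin n) → Fin n × Fin n → Set
  UniqueNeighbourIn C (v , u) = Adj G v u × (∀ {z} → z ∈ C → Adj G v z → z ≡ u)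

  OrientedSemistrong : List (Fin n × Fin n) → Set
  OrientedSemistrong L = Unique (endpoints L) × All (UniqueNeighbourIn (endpoints L)) L

  strong⇒uniqueNeighbour : ∀ {M v u} → Strong G M v → u ∈ covered G M → Adj G v u →
                           UniqueNeighbourIn (covered G M) (v , u)
  strong⇒uniqueNeighbour {v = v} strong u∈ v∼u = v∼u , λ z∈ v∼z →
    ∈-length≡1 strong (∈-filter⁺ (λ y → adj G v y ≟ true) u∈ v∼u)
                      (∈-filter⁺ (λ y → adj G v y ≟ true) z∈ v∼z)

  semistrong⇒oriented : ∀ {M} → Semistrong G M → ∃[ L ] length L ≡ length M × OrientedSemistrong L
  semistrong⇒oriented {M} ((edges , unique) , semistrong) =
    L , orient-length M semistrong , unique-resp-↭ M↭L unique , All.tabulate neighbour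
    where
    L = orient M semistrong

    M↭L : covered G M ↭ endpoints L
    M↭L = ↭-trans (↭-sym (orient-covered M semistrong)) (covered↭endpoints L)

    toM : ∀ {z} → z ∈ endpoints L → z ∈ covered G M
    toM = ∈-resp-↭ (↭-sym M↭L)

    neighbour : ∀ {e} → e ∈ L → UniqueNeighbourIn (endpoints L) e
    neighbour e∈
      with v∼u , only ← strong⇒uniqueNeighbour {M} (All.lookup (orient-first M semistrong) e∈)
                          (toM (∈-++⁺ʳ _ (∈-map⁺ proj₂ e∈)))
                          (All.lookup (orient⁺ adj-sym M semistrong edges) e∈) =
      v∼u , only ∘ toM

  oriented-semistrong⇒legal : ∀ L → OrientedSemistrong L → Legal G (endpoints L)
  oriented-semistrong⇒legal L (unique , neighbours) =
    unique , subst (Legal' G []) first-of-both (footprints⇒legal' (L ++ map swap L) (new , pairs))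
    where
    xs = map proj₁ L
    ys = map proj₂ L

    first-of-both : map proj₁ (L ++ map swap L) ≡ endpoints L
    first-of-both = trans (map-++ proj₁ L (map swap L)) (cong (xs ++_) (sym (map-∘ L)))

    ys-distinct : AllPairs (λ e e′ → ¬ proj₂ e ≡ proj₂ e′) L
    ys-distinct = AllPairsₚ.map⁻ (proj₁ (proj₂ (unique-++⁻ xs unique)))

    x≢y : ∀ {e e′} → e ∈ L → e′ ∈ L → ¬ proj₁ e ≡ proj₂ e′
    x≢y e∈ e′∈ x≡y′ = proj₂ (proj₂ (unique-++⁻ xs unique))
      (∈-map⁺ proj₁ e∈ , subst (_∈ ys) (sym x≡y′) (∈-map⁺ proj₂ e′∈))

    only : ∀ {e z} → e ∈ L → z ∈ endpoints L → Adj G (proj₁ e) z → z ≡ proj₂ e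
    only e∈ = proj₂ (All.lookup neighbours e∈)

    x∈ : ∀ {e} → e ∈ L → proj₁ e ∈ endpoints L
    x∈ e∈ = ∈-++⁺ˡ (∈-map⁺ proj₁ e∈)

    y∈ : ∀ {e} → e ∈ L → proj₂ e ∈ endpoints L
    y∈ e∈ = ∈-++⁺ʳ xs (∈-map⁺ proj₂ e∈)

    new : All (λ (v , u) → Adj G v u × All (λ w → ¬ Adj G w u) []) (L ++ map swap L)
    new = Allₚ.++⁺ (All.map (λ (x∼y , _) → x∼y , []) neighbours)
                   (Allₚ.map⁺ (All.map (λ (x∼y , _) → adj-sym x∼y , []) neighbours))

    x≁later-y : AllPairs (λ e e′ → ¬ Adj G (proj₁ e) (proj₂ e′)) L
    x≁later-y = allPairs-mapWith∈
      (λ e∈ e′∈ y≢y′ x∼y′ → y≢y′ (sym (only e∈ (y∈ e′∈) x∼y′))) ys-distinct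

    y≁later-x : AllPairs (λ e e′ → ¬ Adj G (proj₂ e) (proj₁ e′)) L
    y≁later-x = allPairs-mapWith∈
      (λ e∈ e′∈ y≢y′ y∼x′ → y≢y′ (only e′∈ (y∈ e∈) (adj-sym y∼x′))) ys-distinct

    x≁x : ∀ {e e′} → e ∈ L → e′ ∈ L → ¬ Adj G (proj₁ e) (proj₁ e′)
    x≁x e∈ e′∈ x∼x′ = x≢y e′∈ e∈ (only e∈ (x∈ e′∈) x∼x′)

    pairs : AllPairs (λ (v , _) (_ , u) → ¬ Adj G v u) (L ++ map swap L)
    pairs = AllPairsₚ.++⁺ x≁later-y (AllPairsₚ.map⁺ y≁later-x)
      (All.tabulate λ e∈ → Allₚ.map⁺ (All.tabulate (x≁x e∈)))

corollary3p3 : ∀ {n} (G : Graph n) → Bipartite G → (k m s : ℕ) → IsGrundyTotalDomNumber G k → IsMatchingNumber G m → IsSemistrongMatchingNumber G s → 2 * s ≤ k × k ≤ 2 * m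
corollary3p3 G bipartite k m s ((vs , legal , refl) , γ-max) (_ , ν-max) ((M , semistrong , refl) , _) =
  lower , legal-length≤2*matching G bipartite ν-max legal
  where
  lower : 2 * length M ≤ length vs
  lower with L , |L|≡|M| , oriented ← semistrong⇒oriented G semistrong =
    subst (_≤ length vs) (trans (length-endpoints G L) (cong (2 *_) |L|≡|M|))
      (γ-max (endpoints G L) (oriented-semistrong⇒legal G L oriented))
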